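{- Let $(\mathbf{M},\mathbf{N})$ be an $\mathrm{IMLU}$-category. If $m:A\rightarrowtail B$ is a mono in $\mathbf{N}$ and $B$ is an object of $\mathbf{SCan}_{(\mathbf{M},\mathbf{N})}$, then $A$ is an object of $\mathbf{SCan}_{(\mathbf{M},\mathbf{N})}$ and $m$ is a morphism of $\mathbf{SCan}_{(\mathbf{M},\mathbf{N})}$.
   Context: Heyting category: finite limits, images, covers stable under pullback, each subobject poset a join-semilattice, each pullback map $f^*$ preserving finite joins with adjoints $\exists_f\dashv f^*\dashv\forall_f$. An $\mathrm{IMLU}$-category is a pair $(\mathbf{M},\mathbf{N})$ of Heyting categories with $\mathbf{N}$ a conservative (isomorphism-reflecting) Heyting subcategory of $\mathbf{M}$, together with: an object $U$ of $\mathbf{N}$ such that every object of $\mathbf{N}$ has a mono in $\mathbf{N}$ into $U$; an endofunctor $\mathbf{T}$ of $\mathbf{M}$ restricting to an endofunctor of $\mathbf{N}$ and a natural isomorphism $\iota:\mathrm{id}_\mathbf{M}\to\mathbf{T}$; an endofunctor $\mathbf{P}$ of $\mathbf{N}$ such that for each object $A$ of $\mathbf{N}$ there is $m_{\subseteq^\mathbf{T}_A}:\subseteq^\mathbf{T}_A\to\mathbf{T}A\times\mathbf{P}A$ in $\mathbf{N}$, monic in $\mathbf{M}$, such that for each $r:R\to\mathbf{T}A\times B$ in $\mathbf{N}$ monic in $\mathbf{M}$ there is $\chi:B\to\mathbf{P}A$ in $\mathbf{N}$ which is the unique morphism of $\mathbf{M}$ for which $r$ is a pullback in $\mathbf{M}$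 of $m_{\subseteq^\mathbf{T}_A}$ along $\mathrm{id}\times\chi$; and a natural isomorphism $\mu:\mathbf{P}\mathbf{T}\to\mathbf{T}\mathbf{P}$ on $\mathbf{N}$. An object $X$ of $\mathbf{N}$ is strongly Cantorian if $\iota_X:X\to\mathbf{T}X$ is an isomorphism in $\mathbf{N}$. $\mathbf{SCan}_{(\mathbf{M},\mathbf{N})}$ is the full subcategory of $\mathbf{N}$ on strongly Cantorian objects. -}

module Defs where

open import Level using (Level; _⊔_) renaming (suc to lsuc)
open import Relation.Binary using (Rel; IsEquivalence)
open import Data.Product using (Σ; _×_; _,_; proj₁; proj₂)

record Category (o ℓ e : Level) : Set (lsuc (o ⊔ ℓ ⊔ e)) where
  infixr 9 _∘_
  infix  4 _≈_
  infixr 2 _⇒_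
  field
    Obj       : Set o
    _⇒_       : Obj → Obj → Set ℓ
    _≈_       : ∀ {A B} → Rel (A ⇒ B) e
    id        : ∀ {A} → A ⇒ A
    _∘_       : ∀ {A B C} → B ⇒ C → A ⇒ B → A ⇒ C
    ≈-equiv   : ∀ {A B} → IsEquivalence (_≈_ {A} {B})
    assoc     : ∀ {A B C D} {f : A ⇒ B} {g : B ⇒ C} {h : C ⇒ D} →
                (h ∘ g) ∘ f ≈ h ∘ (g ∘ f)
    identityˡ : ∀ {A B} {f : A ⇒ B} → id ∘ f ≈ f
    identityʳ : ∀ {A B} {f : A ⇒ B} → f ∘ id ≈ f
    ∘-resp-≈  : ∀ {A B C} {f h : B ⇒ C} {g i : A ⇒ B} →
                f ≈ h → g ≈ i → f ∘ g ≈ h ∘ i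

record Functor {o ℓ e o′ ℓ′ e′ : Level}
               (C : Category o ℓ e) (D : Category o′ ℓ′ e′)
               : Set (o ⊔ ℓ ⊔ e ⊔ o′ ⊔ ℓ′ ⊔ e′) where
  private
    module C = Category C
    module D = Category D
  field
    F₀           : C.Obj → D.Obj
    F₁           : ∀ {A B} → C._⇒_ A B → D._⇒_ (F₀ A) (F₀ B)
    identity     : ∀ {A} → D._≈_ (F₁ (C.id {A})) D.id
    homomorphism : ∀ {A B X} {f : C._⇒_ A B} {g : C._⇒_ B X} →
                   D._≈_ (F₁ (C._∘_ g f)) (D._∘_ (F₁ g) (F₁ f))
    F-resp-≈     : ∀ {A B} {f g : C._⇒_ A B} → C._≈_ f g → D._≈_ (F₁ f) (F₁ g)

Idᶠ : ∀ {o ℓ e} (C : Category o ℓ e) → Functor C C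
Idᶠ C = record
  { F₀ = λ A → A
  ; F₁ = λ f → f
  ; identity = IsEquivalence.refl ≈-equiv
  ; homomorphism = IsEquivalence.refl ≈-equiv
  ; F-resp-≈ = λ p → p
  }
  where open Category C

_∘ᶠ_ : ∀ {o ℓ e o′ ℓ′ e′ o″ ℓ″ e″}
         {C : Category o ℓ e} {D : Category o′ ℓ′ e′} {E : Category o″ ℓ″ e″} →
       Functor D E → Functor C D → Functor C E
_∘ᶠ_ {E = E} G F = record
  { F₀ = λ A → G.F₀ (F.F₀ A)
  ; F₁ = λ f → G.F₁ (F.F₁ f)
  ; identity = IsEquivalence.trans E.≈-equiv (G.F-resp-≈ F.identity) G.identity
  ; homomorphism = IsEquivalence.trans E.≈-equiv (G.F-resp-≈ F.homomorphism) G.homomorphism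
  ; F-resp-≈ = λ p → G.F-resp-≈ (F.F-resp-≈ p)
  }
  where
    module E = Category E
    module F = Functor F
    module G = Functor G

module Notions {o ℓ e : Level} (C : Category o ℓ e) where
  open Category C

  Mono : ∀ {A B} → A ⇒ B → Set (o ⊔ ℓ ⊔ e)
  Mono {A} f = ∀ {X} (g h : X ⇒ A) → f ∘ g ≈ f ∘ h → g ≈ h

  Iso : ∀ {A B} → A ⇒ B → Set (ℓ ⊔ e)
  Iso {A} {B} f = Σ (B ⇒ A) λ g → (g ∘ f ≈ id) × (f ∘ g ≈ id)

  IsTerminal : Obj → Set (o ⊔ ℓ ⊔ e)
  IsTerminal T = ∀ X → Σ (X ⇒ T) λ ! → ∀ (f : X ⇒ T) → f ≈ !

  record IsProduct {A B P : Obj} (π₁ : P ⇒ A) (π₂ : P ⇒ B) : Set (o ⊔ ℓ ⊔ e) where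
    field
      ⟨_,_⟩    : ∀ {X} → X ⇒ A → X ⇒ B → X ⇒ P
      project₁ : ∀ {X} {f : X ⇒ A} {g : X ⇒ B} → π₁ ∘ ⟨ f , g ⟩ ≈ f
      project₂ : ∀ {X} {f : X ⇒ A} {g : X ⇒ B} → π₂ ∘ ⟨ f , g ⟩ ≈ g
      unique   : ∀ {X} {f : X ⇒ A} {g : X ⇒ B} (h : X ⇒ P) →
                 π₁ ∘ h ≈ f → π₂ ∘ h ≈ g → h ≈ ⟨ f , g ⟩

  record IsPullback {A B X P : Obj} (f : A ⇒ X) (g : B ⇒ X)
                    (p₁ : P ⇒ A) (p₂ : P ⇒ B) : Set (o ⊔ ℓ ⊔ e) where
    field
      commute    : f ∘ p₁ ≈ g ∘ p₂
      universal  : ∀ {Y} {h : Y ⇒ A} {k : Y ⇒ B} → f ∘ h ≈ g ∘ k → Y ⇒ P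
      p₁∘univ    : ∀ {Y} {h : Y ⇒ A} {k : Y ⇒ B} (eq : f ∘ h ≈ g ∘ k) →
                   p₁ ∘ universal eq ≈ h
      p₂∘univ    : ∀ {Y} {h : Y ⇒ A} {k : Y ⇒ B} (eq : f ∘ h ≈ g ∘ k) →
                   p₂ ∘ universal eq ≈ k
      unique     : ∀ {Y} {h : Y ⇒ A} {k : Y ⇒ B} (eq : f ∘ h ≈ g ∘ k) (u : Y ⇒ P) →
                   p₁ ∘ u ≈ h → p₂ ∘ u ≈ k → u ≈ universal eq

  IsPullbackOf : ∀ {A B S P} (f : A ⇒ B) (n : S ⇒ B) (p : P ⇒ A) → Set (o ⊔ ℓ ⊔ e)
  IsPullbackOf {S = S} {P = P} f n p = Σ (P ⇒ S) λ q → IsPullback f n p q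

  -- preorder of morphisms into a fixed object by factorisation
  -- (on monos: the subobject order)
  infix 4 _≤_
  _≤_ : ∀ {S R A} → S ⇒ A → R ⇒ A → Set (ℓ ⊔ e)
  _≤_ {S} {R} m n = Σ (S ⇒ R) λ h → n ∘ h ≈ m

  record IsImage {A B I : Obj} (f : A ⇒ B) (m : I ⇒ B) : Set (o ⊔ ℓ ⊔ e) where
    field
      mono  : Mono m
      below : f ≤ m
      least : ∀ {S} (n : S ⇒ B) → Mono n → f ≤ n → m ≤ n

  Cover : ∀ {A B} → A ⇒ B → Set (o ⊔ ℓ ⊔ e)
  Cover {B = B} c = ∀ {S} (m : S ⇒ B) → Mono m → c ≤ m → Iso m

  IsBottom : ∀ {A S} → S ⇒ A → Set (o ⊔ ℓ ⊔ e)
  IsBottom {A} b = Mono b × (∀ {R} (n : R ⇒ A) → Mono n → b ≤ n)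

  IsJoin : ∀ {A S R J} → S ⇒ A → R ⇒ A → J ⇒ A → Set (o ⊔ ℓ ⊔ e)
  IsJoin {A} m n j = Mono j × m ≤ j × n ≤ j ×
                     (∀ {K} (k : K ⇒ A) → Mono k → m ≤ k → n ≤ k → j ≤ k)

  _⇔_ : ∀ {a b} → Set a → Set b → Set (a ⊔ b)
  P ⇔ Q = (P → Q) × (Q → P)

  IsExists : ∀ {A B S E} (f : A ⇒ B) (m : S ⇒ A) (a : E ⇒ B) → Set (o ⊔ ℓ ⊔ e)
  IsExists {A} {B} f m a = Mono a ×
    (∀ {R P} (n : R ⇒ B) → Mono n → (p : P ⇒ A) → IsPullbackOf f n p →
       (a ≤ n) ⇔ (m ≤ p))

  IsForall : ∀ {A B S E} (f : A ⇒ B) (m : S ⇒ A) (a : E ⇒ B) → Set (o ⊔ ℓ ⊔ e)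
  IsForall {A} {B} f m a = Mono a ×
    (∀ {R P} (n : R ⇒ B) → Mono n → (p : P ⇒ A) → IsPullbackOf f n p →
       (p ≤ m) ⇔ (n ≤ a))

  record FiniteLimits : Set (o ⊔ ℓ ⊔ e) where
    infixr 7 _×ₒ_
    field
      ⊤          : Obj
      ⊤-terminal : IsTerminal ⊤
      _×ₒ_       : Obj → Obj → Obj
      π₁         : ∀ {A B} → A ×ₒ B ⇒ A
      π₂         : ∀ {A B} → A ×ₒ B ⇒ B
      product    : ∀ {A B} → IsProduct (π₁ {A} {B}) (π₂ {A} {B})
      pullback   : ∀ {A B X} (f : A ⇒ X) (g : B ⇒ X) →
                   Σ Obj λ P → Σ (P ⇒ A) λ p₁ → Σ (P ⇒ B) λ p₂ → IsPullback f g p₁ p₂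

  record IsHeyting : Set (o ⊔ ℓ ⊔ e) where
    field
      limits        : FiniteLimits
      images        : ∀ {A B} (f : A ⇒ B) → Σ Obj λ I → Σ (I ⇒ B) λ m → IsImage f m
      covers-stable : ∀ {A B X P} {f : A ⇒ X} {c : B ⇒ X} {p₁ : P ⇒ A} {p₂ : P ⇒ B} →
                      IsPullback f c p₁ p₂ → Cover c → Cover p₁
      bottom        : ∀ A → Σ Obj λ S → Σ (S ⇒ A) λ b → IsBottom b
      join          : ∀ {A S R} (m : S ⇒ A) (n : R ⇒ A) → Mono m → Mono n →
                      Σ Obj λ J → Σ (J ⇒ A) λ j → IsJoin m n j
      pb-bottom     : ∀ {A B S P} (f : A ⇒ B) (b : S ⇒ B) → IsBottom b →
                      (p : P ⇒ A) → IsPullbackOf f b p → IsBottom p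
      pb-join       : ∀ {A B S R J P Q K} (f : A ⇒ B)
                      (m : S ⇒ B) (n : R ⇒ B) (j : J ⇒ B) →
                      Mono m → Mono n → IsJoin m n j →
                      (pm : P ⇒ A) (pn : Q ⇒ A) (pj : K ⇒ A) →
                      IsPullbackOf f m pm → IsPullbackOf f n pn → IsPullbackOf f j pj →
                      IsJoin pm pn pj
      ∃-adjoint     : ∀ {A B S} (f : A ⇒ B) (m : S ⇒ A) → Mono m →
                      Σ Obj λ E → Σ (E ⇒ B) λ a → IsExists f m a
      ∀-adjoint     : ∀ {A B S} (f : A ⇒ B) (m : S ⇒ A) → Mono m →
                      Σ Obj λ E → Σ (E ⇒ B) λ a → IsForall f m a

record NatIso {o ℓ e o′ ℓ′ e′ : Level}
              {C : Category o ℓ e} {D : Category o′ ℓ′ e′}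
              (F G : Functor C D) : Set (o ⊔ ℓ ⊔ e ⊔ o′ ⊔ ℓ′ ⊔ e′) where
  private
    module C = Category C
    module D = Category D
    module F = Functor F
    module G = Functor G
  open Notions D using (Iso)
  field
    η       : ∀ X → D._⇒_ (F.F₀ X) (G.F₀ X)
    natural : ∀ {X Y} (f : C._⇒_ X Y) →
              D._≈_ (D._∘_ (η Y) (F.F₁ f)) (D._∘_ (G.F₁ f) (η X))
    iso     : ∀ X → Iso (η X)

record Subcategory {o ℓ e : Level} (C : Category o ℓ e) (p q : Level)
                   : Set (o ⊔ ℓ ⊔ e ⊔ lsuc (p ⊔ q)) where
  open Category C
  field
    SObj   : Obj → Set p
    SHom   : ∀ {A B} → A ⇒ B → Set q
    S-id   : ∀ {A} → SObj A → SHom (id {A})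
    S-∘    : ∀ {A B X} {f : A ⇒ B} {g : B ⇒ X} → SHom g → SHom f → SHom (g ∘ f)
    S-resp : ∀ {A B} {f g : A ⇒ B} → f ≈ g → SHom f → SHom g

record SubHom {o ℓ e p q} {C : Category o ℓ e} (S : Subcategory C p q)
              (A B : Σ (Category.Obj C) (Subcategory.SObj S)) : Set (ℓ ⊔ q) where
  constructor _,_
  field
    arr : Category._⇒_ C (proj₁ A) (proj₁ B)
    inS : Subcategory.SHom S arr
open SubHom public

SubCat : ∀ {o ℓ e p q} {C : Category o ℓ e} → Subcategory C p q →
         Category (o ⊔ p) (ℓ ⊔ q) e
SubCat {C = C} S = record
  { Obj = Σ Obj SObj
  ; _⇒_ = SubHom S
  ; _≈_ = λ f g → arr f ≈ arr g
  ; id = λ {A} → id , S-id (proj₂ A)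
  ; _∘_ = λ g f → (arr g ∘ arr f) , S-∘ (inS g) (inS f)
  ; ≈-equiv = record { refl = IsEquivalence.refl ≈-equiv
                     ; sym = IsEquivalence.sym ≈-equiv
                     ; trans = IsEquivalence.trans ≈-equiv }
  ; assoc = assoc
  ; identityˡ = identityˡ
  ; identityʳ = identityʳ
  ; ∘-resp-≈ = ∘-resp-≈
  }
  where
    open Category C
    open Subcategory S

restrict : ∀ {o ℓ e p q} {C : Category o ℓ e} (S : Subcategory C p q) (F : Functor C C) →
           (∀ {A} → Subcategory.SObj S A → Subcategory.SObj S (Functor.F₀ F A)) →
           (∀ {A B} {f : Category._⇒_ C A B} →
              Subcategory.SHom S f → Subcategory.SHom S (Functor.F₁ F f)) →
           Functor (SubCat S) (SubCat S)
restrict S F F-obj F-hom = record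
  { F₀ = λ A → F₀ (proj₁ A) , F-obj (proj₂ A)
  ; F₁ = λ f → F₁ (arr f) , F-hom (inS f)
  ; identity = identity
  ; homomorphism = homomorphism
  ; F-resp-≈ = F-resp-≈
  }
  where open Functor F

record IsHeytingSubcategory {o ℓ e p q} {C : Category o ℓ e} (S : Subcategory C p q)
       : Set (o ⊔ ℓ ⊔ e ⊔ p ⊔ q) where
  private
    N = SubCat S
    module M = Notions C
    module N = Notions N
    module Nc = Category N
    u : ∀ {A B} → Nc._⇒_ A B → Category._⇒_ C (proj₁ A) (proj₁ B)
    u = arr
  field
    pres-terminal : ∀ {T} → N.IsTerminal T → M.IsTerminal (proj₁ T)
    pres-product  : ∀ {A B P} {π₁ : Nc._⇒_ P A} {π₂ : Nc._⇒_ P B} →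
                    N.IsProduct π₁ π₂ → M.IsProduct (u π₁) (u π₂)
    pres-pullback : ∀ {A B X P} {f : Nc._⇒_ A X} {g : Nc._⇒_ B X}
                      {p₁ : Nc._⇒_ P A} {p₂ : Nc._⇒_ P B} →
                    N.IsPullback f g p₁ p₂ → M.IsPullback (u f) (u g) (u p₁) (u p₂)
    pres-image    : ∀ {A B I} {f : Nc._⇒_ A B} {m : Nc._⇒_ I B} →
                    N.IsImage f m → M.IsImage (u f) (u m)
    pres-bottom   : ∀ {A S′} {b : Nc._⇒_ S′ A} → N.IsBottom b → M.IsBottom (u b)
    pres-join     : ∀ {A S′ R J} {m : Nc._⇒_ S′ A} {n : Nc._⇒_ R A} {j : Nc._⇒_ J A} →
                    N.IsJoin m n j → M.IsJoin (u m) (u n) (u j)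
    pres-forall   : ∀ {A B S′ E} {f : Nc._⇒_ A B} {m : Nc._⇒_ S′ A} {a : Nc._⇒_ E B} →
                    N.IsForall f m a → M.IsForall (u f) (u m) (u a)

record IMLU {o ℓ e : Level} (M : Category o ℓ e) (p q : Level)
       : Set (lsuc (o ⊔ ℓ ⊔ e ⊔ p ⊔ q)) where
  open Category M
  open Notions M
  field
    Sub          : Subcategory M p q
  open Subcategory Sub public
  N : Category (o ⊔ p) (ℓ ⊔ q) e
  N = SubCat Sub
  private
    module Nc = Category N
    module NN = Notions N
  field
    M-heyting    : IsHeyting
    N-heyting    : NN.IsHeyting
    heyting-sub  : IsHeytingSubcategory Sub
    conservative : ∀ {A B} (f : Nc._⇒_ A B) → Iso (arr f) → NN.Iso f
    U            : Nc.Obj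
    U-univ       : ∀ (A : Nc.Obj) → Σ (Nc._⇒_ A U) NN.Mono
    T            : Functor M M
    T-obj        : ∀ {A} → SObj A → SObj (Functor.F₀ T A)
    T-hom        : ∀ {A B} {f : A ⇒ B} → SHom f → SHom (Functor.F₁ T f)
    ι            : NatIso (Idᶠ M) T
  TN : Functor N N
  TN = restrict Sub T T-obj T-hom
  open NN.FiniteLimits (NN.IsHeyting.limits N-heyting) public
    renaming (_×ₒ_ to _×N_; π₁ to πN₁; π₂ to πN₂; product to productN)
  idx : ∀ {A B X} → Nc._⇒_ B X → Nc._⇒_ (A ×N B) (A ×N X)
  idx χ = NN.IsProduct.⟨_,_⟩ productN πN₁ (χ Nc.∘ πN₂)
  field
    P            : Functor N N
    ⊆T           : Nc.Obj → Nc.Obj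
    m⊆T          : ∀ A → Nc._⇒_ (⊆T A) (Functor.F₀ TN A ×N Functor.F₀ P A)
    m⊆T-mono     : ∀ A → Mono (arr (m⊆T A))
    comprehension :
      ∀ A {B R} (r : Nc._⇒_ R (Functor.F₀ TN A ×N B)) → Mono (arr r) →
      Σ (Nc._⇒_ B (Functor.F₀ P A)) λ χ →
        IsPullbackOf (arr (idx χ)) (arr (m⊆T A)) (arr r) ×
        (∀ (χ′ : proj₁ B ⇒ proj₁ (Functor.F₀ P A))
           (k : proj₁ (Functor.F₀ TN A ×N B) ⇒ proj₁ (Functor.F₀ TN A ×N Functor.F₀ P A)) →
           arr πN₁ ∘ k ≈ arr πN₁ →
           arr πN₂ ∘ k ≈ χ′ ∘ arr πN₂ →
           IsPullbackOf k (arr (m⊆T A)) (arr r) →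
           χ′ ≈ arr χ)
    μ            : NatIso (P ∘ᶠ TN) (TN ∘ᶠ P)

  IsSCan : Nc.Obj → Set (ℓ ⊔ q ⊔ e)
  IsSCan X = Σ (SHom (NatIso.η ι (proj₁ X))) λ h → NN.Iso {X} {Functor.F₀ TN X} (NatIso.η ι (proj₁ X) , h)

  -- SCan is the full subcategory of N on strongly Cantorian objects,
  -- so an N-morphism is a morphism of SCan iff its domain and codomain are.
  IsSCanMorphism : ∀ {A B} → Nc._⇒_ A B → Set (ℓ ⊔ q ⊔ e)
  IsSCanMorphism {A} {B} _ = IsSCan A × IsSCan B

module Submission where

-- The
-- naturality square  ι_B ∘ m ≈ T m ∘ ι_A  shows that ι_B ∘ m factors through
-- T m, which is a mono of M.  Form the pullback (p₁ , p₂) of T m along ι_B ∘ m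
-- in N; it is still a pullback in M, and a pullback of a mono along a map
-- factoring through it has an invertible first projection p₁ with
-- p₂ ≈ ι_A ∘ p₁.  By conservativity p₁ is invertible in N, so
-- ι_A ≈ p₂ ∘ p₁⁻¹ lies in N, and, being an M-isomorphism, is an
-- N-isomorphism by conservativity again.  Since SCan is full in N, m is then
-- an SCan-morphism.

open import Defs
open import Level using (Level)
open import Data.Product using (_×_; _,_; proj₁; proj₂)
open import Relation.Binary using (Setoid; IsEquivalence)
import Relation.Binary.Reasoning.Setoid as SetoidReasoning

module CategoryFacts {o ℓ e : Level} (C : Category o ℓ e) where
  open Category C
  open Notions C

  hom-setoid : Obj → Obj → Setoid ℓ e
  hom-setoid A B = record { Carrier = A ⇒ B ; _≈_ = _≈_ ; isEquivalence = ≈-equiv }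

  module HomReasoning {A B : Obj} = SetoidReasoning (hom-setoid A B)
  open HomReasoning

  ≈-sym : ∀ {A B} {f g : A ⇒ B} → f ≈ g → g ≈ f
  ≈-sym = IsEquivalence.sym ≈-equiv

  ≈-trans : ∀ {A B} {f g h : A ⇒ B} → f ≈ g → g ≈ h → f ≈ h
  ≈-trans = IsEquivalence.trans ≈-equiv

  ∘-congˡ : ∀ {A B X} {f : B ⇒ X} {g h : A ⇒ B} → g ≈ h → f ∘ g ≈ f ∘ h
  ∘-congˡ p = ∘-resp-≈ (IsEquivalence.refl ≈-equiv) p

  ∘-congʳ : ∀ {A B X} {f g : B ⇒ X} {h : A ⇒ B} → f ≈ g → f ∘ h ≈ g ∘ h
  ∘-congʳ p = ∘-resp-≈ p (IsEquivalence.refl ≈-equiv)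

  split-mono : ∀ {A B} {s : A ⇒ B} {r : B ⇒ A} → r ∘ s ≈ id → Mono s
  split-mono {s = s} {r} rs≈id x y sx≈sy = begin
    x             ≈⟨ ≈-sym identityˡ ⟩
    id ∘ x        ≈⟨ ∘-congʳ (≈-sym rs≈id) ⟩
    (r ∘ s) ∘ x   ≈⟨ assoc ⟩
    r ∘ (s ∘ x)   ≈⟨ ∘-congˡ sx≈sy ⟩
    r ∘ (s ∘ y)   ≈⟨ ≈-sym assoc ⟩
    (r ∘ s) ∘ y   ≈⟨ ∘-congʳ rs≈id ⟩
    id ∘ y        ≈⟨ identityˡ ⟩
    y             ∎

  mono-∘ : ∀ {A B X} {f : B ⇒ X} {g : A ⇒ B} → Mono f → Mono g → Mono (f ∘ g)
  mono-∘ {f = f} {g} f-mono g-mono x y fgx≈fgy =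
    g-mono x y (f-mono (g ∘ x) (g ∘ y) (≈-trans (≈-sym assoc) (≈-trans fgx≈fgy assoc)))

  mono-resp-≈ : ∀ {A B} {f g : A ⇒ B} → f ≈ g → Mono f → Mono g
  mono-resp-≈ f≈g f-mono x y gx≈gy =
    f-mono x y (≈-trans (∘-congʳ f≈g) (≈-trans gx≈gy (∘-congʳ (≈-sym f≈g))))

  -- f is mono iff its kernel pair is trivial, i.e. (id , id) is a pullback
  -- of f along itself.  This characterisation is what a pullback-preserving
  -- functor transports.
  mono⇒trivial-kernel-pair : ∀ {A B} {f : A ⇒ B} → Mono f → IsPullback f f id id
  mono⇒trivial-kernel-pair f-mono = record
    { commute  = IsEquivalence.refl ≈-equiv
    ; universal = λ {_} {h} _ → h
    ; p₁∘univ  = λ _ → identityˡ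
    ; p₂∘univ  = λ {_} {h} {k} fh≈fk → ≈-trans identityˡ (f-mono h k fh≈fk)
    ; unique   = λ _ _ id∘u≈h _ → ≈-trans (≈-sym identityˡ) id∘u≈h
    }

  trivial-kernel-pair⇒mono : ∀ {A B} {f : A ⇒ B} → IsPullback f f id id → Mono f
  trivial-kernel-pair⇒mono kernel-pair x y fx≈fy =
    ≈-trans (≈-sym (p₁∘univ fx≈fy)) (p₂∘univ fx≈fy)
    where open IsPullback kernel-pair

  pullback-along-factoring-map :
    ∀ {A B X P} {f : A ⇒ X} {g : B ⇒ X} {k : A ⇒ B} {p₁ : P ⇒ A} {p₂ : P ⇒ B} →
    Mono g → f ≈ g ∘ k → IsPullback f g p₁ p₂ → Iso p₁ × p₂ ≈ k ∘ p₁
  pullback-along-factoring-map {A} {P = P} {f} {g} {k} {p₁} {p₂} g-mono f≈gk pb =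
    (section , section∘p₁≈id , p₁∘section≈id) , p₂≈kp₁
    where
    open IsPullback pb

    p₂≈kp₁ : p₂ ≈ k ∘ p₁
    p₂≈kp₁ = g-mono p₂ (k ∘ p₁) (begin
      g ∘ p₂         ≈⟨ ≈-sym commute ⟩
      f ∘ p₁         ≈⟨ ∘-congʳ f≈gk ⟩
      (g ∘ k) ∘ p₁   ≈⟨ assoc ⟩
      g ∘ (k ∘ p₁)   ∎)

    -- the pair (id , k) over the cospan yields the inverse of p₁
    f∘id≈g∘k : f ∘ id ≈ g ∘ k
    f∘id≈g∘k = ≈-trans identityʳ f≈gk

    section : A ⇒ P
    section = universal f∘id≈g∘k

    p₁∘section≈id : p₁ ∘ section ≈ id
    p₁∘section≈id = p₁∘univ f∘id≈g∘k

    -- both section ∘ p₁ and id mediate the cone (p₁ , p₂) itself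
    section∘p₁≈id : section ∘ p₁ ≈ id
    section∘p₁≈id = ≈-trans (unique commute (section ∘ p₁) over-p₁ over-p₂)
                            (≈-sym (unique commute id identityʳ identityʳ))
      where
      over-p₁ : p₁ ∘ (section ∘ p₁) ≈ p₁
      over-p₁ = ≈-trans (≈-sym assoc) (≈-trans (∘-congʳ p₁∘section≈id) identityˡ)

      over-p₂ : p₂ ∘ (section ∘ p₁) ≈ p₂
      over-p₂ = ≈-trans (≈-sym assoc)
                        (≈-trans (∘-congʳ (p₂∘univ f∘id≈g∘k)) (≈-sym p₂≈kp₁))

-- An endofunctor naturally isomorphic to the identity preserves monos,
-- since T f ≈ ι_B ∘ f ∘ ι_A⁻¹ is a composite of monos.
natIso-preserves-mono :
  ∀ {o ℓ e} {C : Category o ℓ e} {T : Functor C C} → NatIso (Idᶠ C) T →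
  ∀ {A B} {f : Category._⇒_ C A B} → Notions.Mono C f → Notions.Mono C (Functor.F₁ T f)
natIso-preserves-mono {C = C} {T} ι {A} {B} {f} f-mono =
  mono-resp-≈ conjugate≈Tf
    (mono-∘ (split-mono ιB⁻¹∘ιB≈id) (mono-∘ f-mono (split-mono ιA∘ιA⁻¹≈id)))
  where
  open Category C
  open CategoryFacts C
  open HomReasoning
  open NatIso ι

  ιA⁻¹ : Functor.F₀ T A ⇒ A
  ιA⁻¹ = proj₁ (iso A)

  ιA∘ιA⁻¹≈id : η A ∘ ιA⁻¹ ≈ id
  ιA∘ιA⁻¹≈id = proj₂ (proj₂ (iso A))

  ιB⁻¹∘ιB≈id : proj₁ (iso B) ∘ η B ≈ id
  ιB⁻¹∘ιB≈id = proj₁ (proj₂ (iso B))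

  conjugate≈Tf : η B ∘ (f ∘ ιA⁻¹) ≈ Functor.F₁ T f
  conjugate≈Tf = begin
    η B ∘ (f ∘ ιA⁻¹)                 ≈⟨ ≈-sym assoc ⟩
    (η B ∘ f) ∘ ιA⁻¹                 ≈⟨ ∘-congʳ (natural f) ⟩
    (Functor.F₁ T f ∘ η A) ∘ ιA⁻¹    ≈⟨ assoc ⟩
    Functor.F₁ T f ∘ (η A ∘ ιA⁻¹)    ≈⟨ ∘-congˡ ιA∘ιA⁻¹≈id ⟩
    Functor.F₁ T f ∘ id              ≈⟨ identityʳ ⟩
    Functor.F₁ T f                   ∎

module SubcategoryFacts {o ℓ e p q : Level} {C : Category o ℓ e} (S : Subcategory C p q) where
  open Category C
  open Subcategory S
  private
    module N = Category (SubCat S)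

  sub-mono⇒mono : IsHeytingSubcategory S →
                  ∀ {A B} (m : N._⇒_ A B) → Notions.Mono (SubCat S) m → Notions.Mono C (arr m)
  sub-mono⇒mono heyting-sub m m-mono =
    CategoryFacts.trivial-kernel-pair⇒mono C
      (IsHeytingSubcategory.pres-pullback heyting-sub
        (CategoryFacts.mono⇒trivial-kernel-pair (SubCat S) {f = m} m-mono))

  -- In a conservative subcategory, a morphism k of C that agrees with a
  -- morphism p₂ of S after precomposition with an S-morphism p₁ invertible
  -- in C lies in S:  k ≈ p₂ ∘ p₁⁻¹  with p₁⁻¹ in S by conservativity.
  in-sub-via-iso :
    (∀ {A B} (f : N._⇒_ A B) → Notions.Iso C (arr f) → Notions.Iso (SubCat S) f) →
    ∀ {A P X} (p₁ : N._⇒_ P A) (p₂ : N._⇒_ P X) {k : proj₁ A ⇒ proj₁ X} →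
    Notions.Iso C (arr p₁) → arr p₂ ≈ k ∘ arr p₁ → SHom k
  in-sub-via-iso conservative {A} {P} p₁ p₂ {k} p₁-iso p₂≈kp₁ =
    S-resp (≈-sym k≈p₂∘p₁⁻¹) (S-∘ (inS p₂) (inS p₁⁻¹))
    where
    open CategoryFacts C
    open HomReasoning

    p₁-isoN : Notions.Iso (SubCat S) p₁
    p₁-isoN = conservative p₁ p₁-iso

    p₁⁻¹ : N._⇒_ A P
    p₁⁻¹ = proj₁ p₁-isoN

    k≈p₂∘p₁⁻¹ : k ≈ arr p₂ ∘ arr p₁⁻¹
    k≈p₂∘p₁⁻¹ = begin
      k                               ≈⟨ ≈-sym identityʳ ⟩
      k ∘ id                          ≈⟨ ∘-congˡ (≈-sym (proj₂ (proj₂ p₁-isoN))) ⟩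
      k ∘ (arr p₁ ∘ arr p₁⁻¹)         ≈⟨ ≈-sym assoc ⟩
      (k ∘ arr p₁) ∘ arr p₁⁻¹         ≈⟨ ∘-congʳ (≈-sym p₂≈kp₁) ⟩
      arr p₂ ∘ arr p₁⁻¹               ∎

mainTheorem9 : ∀ {o ℓ e p q : Level} {M : Category o ℓ e} (I : IMLU M p q) →
    ∀ {A B : Category.Obj (IMLU.N I)} (m : Category._⇒_ (IMLU.N I) A B) →
    Notions.Mono (IMLU.N I) m → IMLU.IsSCan I B →
    IMLU.IsSCan I A × IMLU.IsSCanMorphism I m
mainTheorem9 {M = M} I {A} {B} m m-mono B-scan@(ιB∈N , _) = A-scan , A-scan , B-scan
  where
  open IMLU I
  open SubcategoryFacts Sub
  module ι = NatIso ι

  ιB∘m : Category._⇒_ N A (Functor.F₀ TN B)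
  ιB∘m = Category._∘_ N (ι.η (proj₁ B) , ιB∈N) m

  -- T m is a mono of M through which ι_B ∘ m factors, via ι_A
  Tm-mono : Notions.Mono M (Functor.F₁ T (arr m))
  Tm-mono = natIso-preserves-mono ι (sub-mono⇒mono heyting-sub m m-mono)

  -- any N-pullback of T m along ι_B ∘ m is still a pullback in M, hence
  -- trivial there, which exhibits ι_A as an N-morphism
  ιA-in-N : ∀ {P} {p₁ : Category._⇒_ N P A} {p₂ : Category._⇒_ N P (Functor.F₀ TN A)} →
            Notions.IsPullback N ιB∘m (Functor.F₁ TN m) p₁ p₂ → SHom (ι.η (proj₁ A))
  ιA-in-N {p₁ = p₁} {p₂} square =
    in-sub-via-iso conservative p₁ p₂ (proj₁ trivial-in-M) (proj₂ trivial-in-M)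
    where
    trivial-in-M : Notions.Iso M (arr p₁) ×
                   Category._≈_ M (arr p₂) (Category._∘_ M (ι.η (proj₁ A)) (arr p₁))
    trivial-in-M = CategoryFacts.pullback-along-factoring-map M Tm-mono (ι.natural (arr m))
                     (IsHeytingSubcategory.pres-pullback heyting-sub square)

  A-scan : IsSCan A
  A-scan = ιA∈N , conservative (ι.η (proj₁ A) , ιA∈N) (ι.iso (proj₁ A))
    where
    ιA∈N : SHom (ι.η (proj₁ A))
    ιA∈N = ιA-in-N (proj₂ (proj₂ (proj₂ (pullback ιB∘m (Functor.F₁ TN m)))))
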